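{- Let $x\in\mathcal{P}$ (the polyhedron of potentials of the energy game) and let $\chi^+_x\in\{0,1\}^V$ be the characteristic vector of the set $V_x^+$. Then $\chi_x^+$ is a feasible shift for $x$, i.e., $x+\varepsilon\chi_x^+\in\mathcal{P}$ for all sufficiently small $\varepsilon>0$.
   Context: An energy game is given by a finite directed graph $G=(V,E)$ in which every node has at least one outgoing edge, a partition $V=V_{\mathrm{Max}}\sqcup V_{\mathrm{Min}}$ and a weight function $w\colon E\to\mathbb{R}$. Standing assumption: $G$ has no cycle of total weight zero. The polyhedron of potentials $\mathcal{P}$ is the set of $x\in\mathbb{R}^V$ with $x_a\ge w(e)+x_b$ for every $e=(a,b)\in E$ with $a\in V_{\mathrm{Max}}$ and $x_a\le w(e)+x_b$ for every $e=(a,b)\in E$ with $a\in V_{\mathrm{Min}}$. For $x\in\mathcal{P}$, an edge $e=(a,b)$ is tight if $x_a=w(e)+x_b$; $G_x=(V,E_x)$ is the graph of tight edges (it may have sinks). Let $\delta_x\in\mathbb{R}^V$ be the unique solution, with $\lambda=1/2$, of: $\delta_x(s)=-1$ for sinks $s\in V_{\mathrm{Max}}$ of $G_x$, $\delta_x(s)=1$ for sinks $s\in V_{\mathrm{Min}}$ of $G_x$, $\delta_x(a)=\lambda\max_{(a,b)\in E_x}\delta_x(b)$ for non-sink $a\in V_{\mathrm{Max}}$, $\delta_x(a)=\lambda\min_{(a,b)\in E_x}\delta_x(b)$ for non-sink $a\in V_{\mathrm{Min}}$. Set $V_x^+=\{a\in V\mid\delta_x(a)>0\}$. -}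

module Defs where

open import Level using (Level; _⊔_) renaming (suc to lsuc)
open import Data.Nat using (ℕ)
open import Data.Fin using (Fin)
open import Data.Bool using (Bool; true; false; if_then_else_)
open import Data.List using (List; []; _∷_; _++_)
open import Data.List.Relation.Unary.Unique.Propositional using (Unique)
open import Data.Product using (Σ; ∃; _×_)
open import Data.Unit using (⊤)
open import Relation.Nullary using (¬_; does)
open import Relation.Binary.PropositionalEquality using (_≡_)
open import Relation.Binary.Structures using (IsTotalOrder)
open import Algebra.Bundles using (CommutativeRing)
import Data.Rational as ℚ

-- A (linearly) ordered commutative ring.  The paper works with weights and
-- potentials in ℝ, which (classically) is an instance; agda-stdlib has no ℝ.
record OrderedCommRing (c ℓ₁ ℓ₂ : Level) : Set (lsuc (c ⊔ ℓ₁ ⊔ ℓ₂)) where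
  field
    commutativeRing : CommutativeRing c ℓ₁
  open CommutativeRing commutativeRing public
  field
    _≤_          : Carrier → Carrier → Set ℓ₂
    isTotalOrder : IsTotalOrder _≈_ _≤_
    +-monoˡ-≤    : ∀ {x y} z → x ≤ y → (x + z) ≤ (y + z)
    *-nonneg     : ∀ {x y} → 0# ≤ x → 0# ≤ y → 0# ≤ (x * y)
    nontrivial   : ¬ (1# ≈ 0#)

  _<_ : Carrier → Carrier → Set (ℓ₁ ⊔ ℓ₂)
  x < y = (x ≤ y) × ¬ (x ≈ y)

module _ {c ℓ₁ ℓ₂ : Level} (R : OrderedCommRing c ℓ₁ ℓ₂) where
  open OrderedCommRing R

  -- An energy game on the vertex set Fin n.
  --   E a b ≡ true  iff  (a , b) is an edge;  w a b is its weight
  --   isMax a ≡ true iff a ∈ V_Max  (otherwise a ∈ V_Min)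
  record EnergyGame : Set c where
    field
      n      : ℕ
      E      : Fin n → Fin n → Bool
      w      : Fin n → Fin n → Carrier
      isMax  : Fin n → Bool
      outDeg : ∀ a → ∃ λ b → E a b ≡ true

module Game {c ℓ₁ ℓ₂ : Level} (R : OrderedCommRing c ℓ₁ ℓ₂) (G : EnergyGame R) where
  open OrderedCommRing R
  open EnergyGame G

  V : Set
  V = Fin n

  Edge : V → V → Set
  Edge a b = E a b ≡ true

  Walk : List V → Set
  Walk []           = ⊤
  Walk (a ∷ [])     = ⊤
  Walk (a ∷ b ∷ vs) = Edge a b × Walk (b ∷ vs)

  walkWeight : List V → Carrier
  walkWeight []           = 0#
  walkWeight (a ∷ [])     = 0#
  walkWeight (a ∷ b ∷ vs) = w a b + walkWeight (b ∷ vs)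

  NoZeroCycle : Set ℓ₁
  NoZeroCycle = ∀ (v : V) (vs : List V) → Unique (v ∷ vs) →
                Walk (v ∷ vs ++ v ∷ []) → ¬ (walkWeight (v ∷ vs ++ v ∷ []) ≈ 0#)

  InP : (V → Carrier) → Set ℓ₂
  InP x = ∀ a b → Edge a b →
            (isMax a ≡ true  → (w a b + x b) ≤ x a) ×
            (isMax a ≡ false → x a ≤ (w a b + x b))

  Tight : (V → Carrier) → V → V → Set ℓ₁
  Tight x a b = Edge a b × (x a ≈ (w a b + x b))

  Sink : (V → Carrier) → V → Set ℓ₁
  Sink x a = ∀ b → ¬ Tight x a b

  -- δ is a solution (with λ = 1/2) of the defining system of δ_x
  IsDelta : (V → Carrier) → (V → ℚ.ℚ) → Set ℓ₁
  IsDelta x δ = ∀ a →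
      (Sink x a → isMax a ≡ true  → δ a ≡ ℚ.-_ ℚ.1ℚ) ×
      (Sink x a → isMax a ≡ false → δ a ≡ ℚ.1ℚ) ×
      (¬ Sink x a → isMax a ≡ true →
         Σ V λ b → Tight x a b × (δ a ≡ ℚ.½ ℚ.* δ b) ×
                   (∀ b′ → Tight x a b′ → δ b′ ℚ.≤ δ b)) ×
      (¬ Sink x a → isMax a ≡ false →
         Σ V λ b → Tight x a b × (δ a ≡ ℚ.½ ℚ.* δ b) ×
                   (∀ b′ → Tight x a b′ → δ b ℚ.≤ δ b′))

  chiPlus : (V → ℚ.ℚ) → V → Carrier
  chiPlus δ a = if does (ℚ.0ℚ ℚ.<? δ a) then 1# else 0#

  FeasibleShift : (V → Carrier) → (V → Carrier) → Set (c ⊔ ℓ₁ ⊔ ℓ₂)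
  FeasibleShift x d = Σ Carrier λ ε₀ → (0# < ε₀) ×
      (∀ ε → 0# < ε → ε ≤ ε₀ → InP (λ a → x a + ε * d a))

module Submission where

-- Write χ for the characteristic vector of V⁺ and let (a , b) be an edge.
-- Its constraint has the form  lo ≤ hi  (lo = w(a,b) + x_b, hi = x_a for a
-- Max vertex a, and the reverse for a Min vertex).  Adding ε·χ to x adds
-- ε·χ to both sides, which can only break the constraint when the side lo
-- gains ε and hi gains nothing.  We call such edges critical: a ∈ V_Max with
-- b ∈ V⁺, a ∉ V⁺, or a ∈ V_Min with a ∈ V⁺, b ∉ V⁺.  The recursion defining
-- δ_x shows that critical edges are never tight, so each one has a positive
-- slack; since there are finitely many edges, a single ε₀ > 0 lies below all
-- slacks, and every ε ∈ (0 , ε₀] is then a feasible step.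

open import Defs
open import Level using (Level)
import Data.Rational as ℚ
import Data.Rational.Properties as ℚP
open import Data.Nat using (zero; suc)
open import Data.Fin using (Fin; zero; suc)
open import Data.Bool using (true; false; if_then_else_)
import Data.Bool as Bool
open import Data.Product using (Σ; _×_; _,_; proj₁; proj₂)
open import Data.Sum using (inj₁; inj₂)
open import Data.Empty using (⊥-elim)
open import Relation.Nullary using (¬_; Dec; yes; no; does)
open import Relation.Nullary.Decidable using (_×-dec_; ¬?)
open import Relation.Binary.PropositionalEquality using (_≡_)
  renaming (refl to ≡-refl; sym to ≡-sym; trans to ≡-trans; subst to ≡-subst)
open import Relation.Binary.Structures using (IsTotalOrder)
import Algebra.Properties.Ring as RingProperties

module OrderedRingFacts {c ℓ₁ ℓ₂ : Level} (R : OrderedCommRing c ℓ₁ ℓ₂) where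
  open OrderedCommRing R hiding (zero)
  open IsTotalOrder isTotalOrder
    using (total; ≤-respˡ-≈; ≤-respʳ-≈) renaming (refl to ≤-refl; trans to ≤-trans)
  open RingProperties ring using (-1*x≈-x; -‿involutive)

  ≤-resp-≈ : ∀ {u u′ v v′} → u ≈ u′ → v ≈ v′ → u ≤ v → u′ ≤ v′
  ≤-resp-≈ u≈u′ v≈v′ u≤v = ≤-respˡ-≈ u≈u′ (≤-respʳ-≈ v≈v′ u≤v)

  +-mono-≤ : ∀ {u v p q} → u ≤ v → p ≤ q → (u + p) ≤ (v + q)
  +-mono-≤ {u} {v} {p} {q} u≤v p≤q =
    ≤-trans (+-monoˡ-≤ p u≤v) (≤-resp-≈ (+-comm p v) (+-comm q v) (+-monoˡ-≤ v p≤q))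

  -- 1 is positive: otherwise -1 ≥ 0 and 1 = (-1)·(-1) ≥ 0 anyway.
  0≤1 : 0# ≤ 1#
  0≤1 with total 0# 1#
  ... | inj₁ 0≤1 = 0≤1
  ... | inj₂ 1≤0 = ≤-resp-≈ refl (-1*-1≈1) (*-nonneg 0≤-1 0≤-1)
    where
    0≤-1 : 0# ≤ (- 1#)
    0≤-1 = ≤-resp-≈ (-‿inverseʳ 1#) (+-identityˡ (- 1#)) (+-monoˡ-≤ (- 1#) 1≤0)
    -1*-1≈1 : (- 1#) * (- 1#) ≈ 1#
    -1*-1≈1 = trans (-1*x≈-x (- 1#)) (-‿involutive 1#)

  0<1 : 0# < 1#
  0<1 = 0≤1 , λ 0≈1 → nontrivial (sym 0≈1)

  strict-gap : ∀ {u v} → u ≤ v → ¬ (u ≈ v) → Σ Carrier λ s → 0# < s × (u + s) ≤ v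
  strict-gap {u} {v} u≤v u≉v = v - u , (0≤v-u , 0≉v-u) , ≤-resp-≈ refl u+[v-u]≈v ≤-refl
    where
    open import Relation.Binary.Reasoning.Setoid setoid
    u+[v-u]≈v : u + (v - u) ≈ v
    u+[v-u]≈v = begin
      u + (v - u)   ≈⟨ +-congˡ (+-comm v (- u)) ⟩
      u + (- u + v) ≈⟨ sym (+-assoc u (- u) v) ⟩
      (u - u) + v   ≈⟨ +-congʳ (-‿inverseʳ u) ⟩
      0# + v        ≈⟨ +-identityˡ v ⟩
      v             ∎
    0≤v-u : 0# ≤ (v - u)
    0≤v-u = ≤-resp-≈ (-‿inverseʳ u) refl (+-monoˡ-≤ (- u) u≤v)
    0≉v-u : ¬ (0# ≈ v - u)
    0≉v-u 0≈v-u = u≉v (trans (sym (+-identityʳ u)) (trans (+-congˡ 0≈v-u) u+[v-u]≈v))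

  common-positive-bound : ∀ {p} m (P : Fin m → Carrier → Set p) →
    (∀ i {s t} → t ≤ s → P i s → P i t) →
    (∀ i → Σ Carrier λ s → 0# < s × P i s) →
    Σ Carrier λ e → 0# < e × (∀ i → P i e)
  common-positive-bound zero P _ _ = 1# , 0<1 , λ ()
  common-positive-bound (suc m) P down witness
    with common-positive-bound m (λ i → P (suc i)) (λ i → down (suc i)) (λ i → witness (suc i))
       | witness zero
  ... | e , 0<e , Pe | s , 0<s , Ps with total e s
  ... | inj₁ e≤s = e , 0<e , λ { zero → down zero e≤s Ps ; (suc i) → Pe i }
  ... | inj₂ s≤e = s , 0<s , λ { zero → Ps ; (suc i) → down (suc i) s≤e (Pe i) }

  indicator : ∀ {p} {P : Set p} → Dec P → Carrier
  indicator d = if does d then 1# else 0#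

  shifted-constraint : ∀ {p q} {P : Set p} {Q : Set q} {lo hi ε} →
    0# ≤ ε → lo ≤ hi → (dP : Dec P) (dQ : Dec Q) → (P → ¬ Q → (lo + ε) ≤ hi) →
    (lo + ε * indicator dP) ≤ (hi + ε * indicator dQ)
  shifted-constraint _ lo≤hi (yes _) (yes _) _ = +-mono-≤ lo≤hi ≤-refl
  shifted-constraint _ lo≤hi (no _)  (no _)  _ = +-mono-≤ lo≤hi ≤-refl
  shifted-constraint {ε = ε} 0≤ε lo≤hi (no _) (yes _) _ =
    +-mono-≤ lo≤hi (≤-resp-≈ (sym (zeroʳ ε)) (sym (*-identityʳ ε)) 0≤ε)
  shifted-constraint {hi = hi} {ε} _ _ (yes p) (no ¬q) harmful =
    ≤-resp-≈ (+-congˡ (sym (*-identityʳ ε)))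
             (trans (sym (+-identityʳ hi)) (+-congˡ (sym (zeroʳ ε))))
             (harmful p ¬q)

  slack-mono : ∀ {u v s t} → t ≤ s → (u + s) ≤ v → (u + t) ≤ v
  slack-mono t≤s u+s≤v = ≤-trans (+-mono-≤ ≤-refl t≤s) u+s≤v

module FeasibleShiftProof {c ℓ₁ ℓ₂ : Level} (R : OrderedCommRing c ℓ₁ ℓ₂) (G : EnergyGame R)
  (x : Game.V R G → OrderedCommRing.Carrier R) (δ : Game.V R G → ℚ.ℚ) where
  open OrderedCommRing R hiding (zero)
  open EnergyGame G
  open Game R G
  open OrderedRingFacts R

  Pos : V → Set
  Pos a = ℚ.0ℚ ℚ.< δ a

  Pos? : ∀ a → Dec (Pos a)
  Pos? a = ℚ.0ℚ ℚ.<? δ a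

  -- A Max vertex with a tight edge into V⁺ lies in V⁺: its δ is half the
  -- maximum of δ over its tight successors.
  max-positive-successor : IsDelta x δ → ∀ {a b} → isMax a ≡ true →
    Tight x a b → Pos b → Pos a
  max-positive-successor isDelta {a} {b} isMaxa tight posb
    with isDelta a
  ... | _ , _ , maxRule , _ with maxRule (λ sink → sink b tight) isMaxa
  ... | b* , _ , δa≡½δb* , maximal =
    ≡-subst (ℚ.0ℚ ℚ.<_) (≡-sym δa≡½δb*)
      (ℚP.*-monoʳ-<-pos ℚ.½ (ℚP.<-≤-trans posb (maximal b tight)))

  -- A Min vertex with a tight edge leaving V⁺ lies outside V⁺: its δ is half
  -- the minimum of δ over its tight successors.
  min-nonpositive-successor : IsDelta x δ → ∀ {a b} → isMax a ≡ false →
    Tight x a b → ¬ Pos b → ¬ Pos a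
  min-nonpositive-successor isDelta {a} {b} isMina tight ¬posb posa
    with isDelta a
  ... | _ , _ , _ , minRule with minRule (λ sink → sink b tight) isMina
  ... | b* , _ , δa≡½δb* , minimal =
    ℚP.<-irrefl ≡-refl (ℚP.<-≤-trans posa (≡-subst (ℚ._≤ ℚ.0ℚ) (≡-sym δa≡½δb*)
      (ℚP.*-monoˡ-≤-nonNeg ℚ.½ (ℚP.≤-trans (minimal b tight) (ℚP.≮⇒≥ ¬posb)))))

  -- The edges whose constraint is endangered by shifting x along χ⁺.
  MaxCritical MinCritical : V → V → Set
  MaxCritical a b = Edge a b × isMax a ≡ true × Pos b × ¬ Pos a
  MinCritical a b = Edge a b × isMax a ≡ false × Pos a × ¬ Pos b

  maxCritical? : ∀ a b → Dec (MaxCritical a b)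
  maxCritical? a b = (E a b Bool.≟ true) ×-dec (isMax a Bool.≟ true) ×-dec Pos? b ×-dec ¬? (Pos? a)

  minCritical? : ∀ a b → Dec (MinCritical a b)
  minCritical? a b = (E a b Bool.≟ true) ×-dec (isMax a Bool.≟ false) ×-dec Pos? a ×-dec ¬? (Pos? b)

  SlackBound : V → V → Carrier → Set ℓ₂
  SlackBound a b s = (MaxCritical a b → ((w a b + x b) + s) ≤ x a) ×
                     (MinCritical a b → (x a + s) ≤ (w a b + x b))

  slackBound-mono : ∀ a b {s t} → t ≤ s → SlackBound a b s → SlackBound a b t
  slackBound-mono a b t≤s (maxSlack , minSlack) =
    (λ crit → slack-mono t≤s (maxSlack crit)) , (λ crit → slack-mono t≤s (minSlack crit))

  max-and-min : ∀ {p} {A : Set p} {a} → isMax a ≡ true → isMax a ≡ false → A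
  max-and-min isMaxa isMina with ≡-trans (≡-sym isMaxa) isMina
  ... | ()

  -- Critical edges are not tight, so every edge admits a positive slack bound.
  positive-slack : InP x → IsDelta x δ → ∀ a b → Σ Carrier λ s → 0# < s × SlackBound a b s
  positive-slack inP isDelta a b with maxCritical? a b | minCritical? a b
  ... | yes (e , isMaxa , posb , ¬posa) | _ =
    let s , 0<s , gap = strict-gap (proj₁ (inP a b e) isMaxa)
          (λ lo≈hi → ¬posa (max-positive-successor isDelta isMaxa (e , sym lo≈hi) posb))
    in s , 0<s , (λ _ → gap) , λ (_ , isMina , _) → max-and-min isMaxa isMina
  ... | no _ | yes (e , isMina , posa , ¬posb) =
    let s , 0<s , gap = strict-gap (proj₂ (inP a b e) isMina)
          (λ lo≈hi → min-nonpositive-successor isDelta isMina (e , lo≈hi) ¬posb posa)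
    in s , 0<s , (λ (_ , isMaxa , _) → max-and-min isMaxa isMina) , λ _ → gap
  ... | no ¬maxCrit | no ¬minCrit =
    1# , 0<1 , (λ crit → ⊥-elim (¬maxCrit crit)) , (λ crit → ⊥-elim (¬minCrit crit))

  uniform-slack : InP x → IsDelta x δ →
    Σ Carrier λ ε₀ → 0# < ε₀ × (∀ a b → SlackBound a b ε₀)
  uniform-slack inP isDelta =
    common-positive-bound n (λ a s → ∀ b → SlackBound a b s)
      (λ a t≤s bounds b → slackBound-mono a b t≤s (bounds b))
      (λ a → common-positive-bound n (SlackBound a) (slackBound-mono a) (positive-slack inP isDelta a))

  shift-within-slack : InP x → ∀ {ε} → 0# ≤ ε → (∀ a b → SlackBound a b ε) →
    InP (λ a → x a + ε * chiPlus δ a)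
  shift-within-slack inP {ε} 0≤ε bound a b e = maxConstraint , minConstraint
    where
    x′ : V → Carrier
    x′ c = x c + ε * chiPlus δ c
    maxConstraint : isMax a ≡ true → (w a b + x′ b) ≤ x′ a
    maxConstraint isMaxa = ≤-resp-≈ (+-assoc _ _ _) refl
      (shifted-constraint 0≤ε (proj₁ (inP a b e) isMaxa) (Pos? b) (Pos? a)
        (λ posb ¬posa → proj₁ (bound a b) (e , isMaxa , posb , ¬posa)))
    minConstraint : isMax a ≡ false → x′ a ≤ (w a b + x′ b)
    minConstraint isMina = ≤-resp-≈ refl (+-assoc _ _ _)
      (shifted-constraint 0≤ε (proj₂ (inP a b e) isMina) (Pos? a) (Pos? b)
        (λ posa ¬posb → proj₂ (bound a b) (e , isMina , posa , ¬posb)))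

lemma5 : ∀ {c ℓ₁ ℓ₂ : Level} (R : OrderedCommRing c ℓ₁ ℓ₂) (G : EnergyGame R) →
    Game.NoZeroCycle R G →
    (x : Game.V R G → OrderedCommRing.Carrier R) → Game.InP R G x →
    (δ : Game.V R G → ℚ.ℚ) → Game.IsDelta R G x δ →
    Game.FeasibleShift R G x (Game.chiPlus R G δ)
lemma5 R G _ x inP δ isDelta =
  let ε₀ , 0<ε₀ , bound = uniform-slack inP isDelta
  in ε₀ , 0<ε₀ , λ ε (0≤ε , _) ε≤ε₀ →
       shift-within-slack inP 0≤ε (λ a b → slackBound-mono a b ε≤ε₀ (bound a b))
  where
  open FeasibleShiftProof R G x δ
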